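{- For integers $m\ge 1$, define the incomplete Lehmer-Euler numbers $W_{n,\le m}$ and $W_{n,\ge m}$ by $$\sum_{n=0}^\infty W_{n,\le m}\frac{t^n}{n!}=\frac{1}{1+\sum_{l=1}^m\frac{t^{3l}}{(3l)!}},\qquad \sum_{n=0}^\infty W_{n,\ge m}\frac{t^n}{n!}=\frac{1}{1+\sum_{l=m}^\infty\frac{t^{3l}}{(3l)!}}.$$ Then: (i)(a) $W_{0,\le m}=1$ and for $n\ge1$, $W_{3n,\le m}=-\sum_{k=\max\{n-m,0\}}^{n-1}\binom{3n}{3k}W_{3k,\le m}$. (i)(b) $W_{0,\ge m}=1$, $W_{3,\ge m}=\cdots=W_{3m-3,\ge m}=0$, and for $n\ge m$, $W_{3n,\ge m}=-\sum_{k=0}^{n-m}\binom{3n}{3k}W_{3k,\ge m}$. (ii) For $n,m\ge1$, $$W_{3n,\le m}=(3n)!\sum_{k=1}^n(-1)^k\sum_{\substack{i_1+\cdots+i_k=n\\ 1\le i_1,\dots,i_k\le m}}\frac{1}{(3i_1)!\cdots(3i_k)!},\qquad W_{3n,\ge m}=(3n)!\sum_{k=1}^n(-1)^k\sum_{\substack{i_1+\cdots+i_k=n\\ i_1,\dots,i_k\ge m}}\frac{1}{(3i_1)!\cdots(3i_k)!}.$$ (iii) For $n\ge m\ge 1$, $W_{3n,\le m}=(-1)^n(3n)!\det A$ and $W_{3n,\ge m}=(-1)^n(3n)!\det B$, where $A=(a_{ij})$ and $B=(b_{ij})$ are the $n\times n$ matrices ($1\le i,j\le n$) given by: $a_{ij}=b_{ij}=1$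 if $j=i+1$; $a_{ij}=\frac{1}{(3(i-j+1))!}$ if $0\le i-j\le m-1$, and $a_{ij}=0$ otherwise (for $j\ne i+1$); $b_{ij}=\frac{1}{(3(i-j+1))!}$ if $i-j+1\ge m$, and $b_{ij}=0$ otherwise (for $j\ne i+1$). -}

module Defs where

open import Data.Bool using (Bool; true; false; if_then_else_; _∧_; _∨_)
open import Data.Nat as ℕ using (ℕ; zero; suc; _∸_; _!; _≡ᵇ_; _≤ᵇ_; _%_)
open import Data.Nat.Properties using (_!≢0)
open import Data.Nat.Combinatorics using (_C_)
open import Data.Integer using (+_)
open import Data.Fin using (Fin; toℕ; punchIn) renaming (zero to fzero; suc to fsuc)
open import Data.List using (List; []; _∷_; map; foldr; applyUpTo; allFin; concatMap; filterᵇ)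
open import Data.List.Base using (all)
open import Data.Nat.ListAction using (sum)
open import Data.Rational using (ℚ; 0ℚ; 1ℚ; _+_; _*_; -_; _/_)
open import Relation.Binary.PropositionalEquality using (_≡_)

ofℕ : ℕ → ℚ
ofℕ n = + n / 1

invFact : ℕ → ℚ
invFact n = (+ 1 / (n !)) {{n !≢0}}

neg1^ : ℕ → ℚ
neg1^ zero    = 1ℚ
neg1^ (suc k) = - neg1^ k

binom : ℕ → ℕ → ℚ
binom n k = ofℕ (n C k)

sumℚ : List ℚ → ℚ
sumℚ = foldr _+_ 0ℚ

-- Σ_{k=a}^{b} f k  (empty, i.e. 0, if b < a)
Σ[_⋯_] : ℕ → ℕ → (ℕ → ℚ) → ℚ
Σ[ a ⋯ b ] f = sumℚ (applyUpTo (λ i → f (a ℕ.+ i)) (suc b ∸ a))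

-- Kronecker delta at 0: coefficient of t^n in the power series 1
δ₀ : ℕ → ℚ
δ₀ zero    = 1ℚ
δ₀ (suc _) = 0ℚ

-- coefficient of t^j in  1 + Σ_{l=1}^{m} t^{3l}/(3l)!
-- (j = 3l with 0 ≤ l ≤ m; l = 0 gives the constant term 1 = 1/0!)
denLe : ℕ → ℕ → ℚ
denLe m j = if (j % 3 ≡ᵇ 0) ∧ (j ℕ./ 3 ≤ᵇ m) then invFact j else 0ℚ

-- coefficient of t^j in  1 + Σ_{l=m}^{∞} t^{3l}/(3l)!   (m ≥ 1)
denGe : ℕ → ℕ → ℚ
denGe m j = if (j ≡ᵇ 0) ∨ ((j % 3 ≡ᵇ 0) ∧ (m ≤ᵇ j ℕ./ 3)) then invFact j else 0ℚ

-- W is the coefficient sequence of the exponential generating function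
-- Σ W n t^n / n!  which is the multiplicative inverse of the formal power
-- series with coefficients den:  (Σ (W n / n!) t^n) · (Σ den j t^j) = 1,
-- compared coefficientwise.
IsEGFInverseOf : (ℕ → ℚ) → (ℕ → ℚ) → Set
IsEGFInverseOf den W = ∀ n → Σ[ 0 ⋯ n ] (λ k → (W k * invFact k) * den (n ∸ k)) ≡ δ₀ n

IsWLe : ℕ → (ℕ → ℚ) → Set
IsWLe m W = IsEGFInverseOf (denLe m) W

IsWGe : ℕ → (ℕ → ℚ) → Set
IsWGe m W = IsEGFInverseOf (denGe m) W

tuples : ℕ → ℕ → List (List ℕ)
tuples zero    n = [] ∷ []
tuples (suc k) n = concatMap (λ i → map (i ∷_) (tuples k n)) (applyUpTo suc n)

compSum : (ℕ → Bool) → ℕ → ℕ → ℚ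
compSum ok n k =
  sumℚ (map (λ xs → foldr (λ i q → invFact (3 ℕ.* i) * q) 1ℚ xs)
            (filterᵇ (λ xs → (sum xs ≡ᵇ n) ∧ all ok xs) (tuples k n)))

det : ∀ n → (Fin n → Fin n → ℚ) → ℚ
det zero    M = 1ℚ
det (suc n) M =
  sumℚ (map (λ j → neg1^ (toℕ j) * (M fzero j * det n (λ r c → M (fsuc r) (punchIn j c))))
            (allFin (suc n)))

-- The matrices A and B of (iii); indices 0-based (the shift does not
-- change differences i - j).
matA : ℕ → ∀ n → Fin n → Fin n → ℚ
matA m n i j =
  if toℕ j ≡ᵇ suc (toℕ i) then 1ℚ
  else if (toℕ j ≤ᵇ toℕ i) ∧ (suc (toℕ i ∸ toℕ j) ≤ᵇ m) then invFact (3 ℕ.* suc (toℕ i ∸ toℕ j))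
  else 0ℚ

matB : ℕ → ∀ n → Fin n → Fin n → ℚ
matB m n i j =
  if toℕ j ≡ᵇ suc (toℕ i) then 1ℚ
  else if (toℕ j ≤ᵇ toℕ i) ∧ (m ≤ᵇ suc (toℕ i ∸ toℕ j)) then invFact (3 ℕ.* suc (toℕ i ∸ toℕ j))
  else 0ℚ

-- The denominators only have terms in degrees divisible by 3, so sampling the EGF identity at
-- multiples of 3 leaves an ordinary power series identity c · (1 + Σ_{j≥1} v_j t^j) = 1, where
-- c_n = W_{3n}/(3n)! and v_j = 1/(3j)! for the admissible j (j ≤ m, resp. j ≥ m) and 0 otherwise.
-- Solving it for its last term gives the recurrences (i); truncating the geometric series
-- 1/(1 + x) = Σ_k (−x)^k gives the composition sums (ii); and the Laplace expansion of the
-- Toeplitz–Hessenberg determinants satisfies the same recurrence as c (iii).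
{-# OPTIONS --safe #-}
module Submission where

open import Defs
open import Data.Nat using (ℕ; _≤_; _∸_; _!; _*_; _≤ᵇ_)
open import Data.Product using (_×_)
open import Data.Rational using (ℚ; 0ℚ; 1ℚ; -_) renaming (_*_ to _*ℚ_)
open import Relation.Binary.PropositionalEquality using (_≡_)

open import Data.Bool using (Bool; true; false; if_then_else_; _∧_; _∨_)
open import Data.Fin using (Fin; toℕ; punchIn) renaming (zero to fzero; suc to fsuc)
open import Data.Integer using (+_)
import Data.Integer.Properties as ℤ
open import Data.List using (List; []; _∷_; _++_; map; foldr; applyUpTo; concatMap; filterᵇ; tabulate)
open import Data.Bool.ListAction using (all)
open import Data.List.Properties using (map-∘; map-cong; map-++; map-tabulate)
open import Data.Nat using (zero; suc; _+_; _<_; _≡ᵇ_; _%_; NonZero; z≤n; s≤s; z<s; _≟_; _≤?_)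
open import Data.Nat.Base using () renaming (_/_ to _div_)
open import Data.Nat.Combinatorics using (_C_; k![n∸k]!∣n!)
open import Data.Nat.Combinatorics.Specification using (nCk≡n!/k![n-k]!)
import Data.Nat.Coprimality as Coprime
open import Data.Nat.DivMod using (m/n*n≡m; m*n%n≡0; m*n/n≡m)
open import Data.Nat.Divisibility
  using (_∣_; _∤_; ∣m+n∣m⇒∣n; ∣-refl; >⇒∤; m∣m*n; m%n≡0⇒n∣m; _∣0)
open import Data.Nat.Induction using (<-rec)
open import Data.Nat.ListAction using (sum)
import Data.Nat.Properties as ℕ
open import Data.Nat.Properties using (_!≢0; _!*_!≢0)
open import Data.Product using (_,_)
open import Data.Rational using (mkℚ; _/_) renaming (_+_ to _+ℚ_)
import Data.Rational.Properties as ℚ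
open import Algebra.Properties.Group ℚ.+-0-group using (inverseʳ-unique)
open import Data.Rational.Solver using (module +-*-Solver)
open import Function using (_∘_)
open import Relation.Binary.PropositionalEquality
  using (refl; sym; trans; cong; cong₂; subst; module ≡-Reasoning)
open import Relation.Nullary using (contradiction)
open import Relation.Nullary.Decidable using (dec-true; dec-false)

open +-*-Solver using (solve; _:+_; _:*_; :-_; _:=_; con)
open ≡-Reasoning

∑< : ℕ → (ℕ → ℚ) → ℚ
∑< zero    f = 0ℚ
∑< (suc n) f = f 0 +ℚ ∑< n (λ i → f (suc i))

sumℚ-applyUpTo : ∀ n f → sumℚ (applyUpTo f n) ≡ ∑< n f
sumℚ-applyUpTo zero    f = refl
sumℚ-applyUpTo (suc n) f = cong (f 0 +ℚ_) (sumℚ-applyUpTo n (λ i → f (suc i)))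

Σ[⋯]≡∑< : ∀ a b f → Σ[ a ⋯ b ] f ≡ ∑< (suc b ∸ a) (λ i → f (a + i))
Σ[⋯]≡∑< a b f = sumℚ-applyUpTo (suc b ∸ a) (λ i → f (a + i))

∑<-cong : ∀ n {f g} → (∀ i → i < n → f i ≡ g i) → ∑< n f ≡ ∑< n g
∑<-cong zero    f≡g = refl
∑<-cong (suc n) f≡g = cong₂ _+ℚ_ (f≡g 0 z<s) (∑<-cong n (λ i i<n → f≡g (suc i) (s≤s i<n)))

Σ[⋯]-cong : ∀ a b {f g} → (∀ k → f k ≡ g k) → Σ[ a ⋯ b ] f ≡ Σ[ a ⋯ b ] g
Σ[⋯]-cong a b {f} {g} f≡g = begin
  Σ[ a ⋯ b ] f                      ≡⟨ Σ[⋯]≡∑< a b f ⟩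
  ∑< (suc b ∸ a) (λ i → f (a + i))  ≡⟨ ∑<-cong (suc b ∸ a) (λ i _ → f≡g (a + i)) ⟩
  ∑< (suc b ∸ a) (λ i → g (a + i))  ≡⟨ sym (Σ[⋯]≡∑< a b g) ⟩
  Σ[ a ⋯ b ] g                      ∎

∑<-zero : ∀ n {f} → (∀ i → i < n → f i ≡ 0ℚ) → ∑< n f ≡ 0ℚ
∑<-zero zero    f≡0 = refl
∑<-zero (suc n) f≡0 = cong₂ _+ℚ_ (f≡0 0 z<s) (∑<-zero n (λ i i<n → f≡0 (suc i) (s≤s i<n)))

∑<-+ : ∀ n f g → ∑< n (λ i → f i +ℚ g i) ≡ ∑< n f +ℚ ∑< n g
∑<-+ zero    f g = refl
∑<-+ (suc n) f g = begin
  (f 0 +ℚ g 0) +ℚ ∑< n (λ i → f (suc i) +ℚ g (suc i))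
    ≡⟨ cong ((f 0 +ℚ g 0) +ℚ_) (∑<-+ n (f ∘ suc) (g ∘ suc)) ⟩
  (f 0 +ℚ g 0) +ℚ (∑< n (f ∘ suc) +ℚ ∑< n (g ∘ suc))
    ≡⟨ solve 4 (λ a b c d → (a :+ b) :+ (c :+ d) := (a :+ c) :+ (b :+ d)) refl
               (f 0) (g 0) (∑< n (f ∘ suc)) (∑< n (g ∘ suc)) ⟩
  (f 0 +ℚ ∑< n (f ∘ suc)) +ℚ (g 0 +ℚ ∑< n (g ∘ suc))
    ∎

*-distribˡ-∑< : ∀ n a f → a *ℚ ∑< n f ≡ ∑< n (λ i → a *ℚ f i)
*-distribˡ-∑< zero    a f = ℚ.*-zeroʳ a
*-distribˡ-∑< (suc n) a f =
  trans (ℚ.*-distribˡ-+ a (f 0) _) (cong (a *ℚ f 0 +ℚ_) (*-distribˡ-∑< n a (f ∘ suc)))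

neg-distrib-∑< : ∀ n f → - ∑< n f ≡ ∑< n (λ i → - f i)
neg-distrib-∑< zero    f = refl
neg-distrib-∑< (suc n) f =
  trans (ℚ.neg-distrib-+ (f 0) _) (cong (- f 0 +ℚ_) (neg-distrib-∑< n (f ∘ suc)))

∑<-last : ∀ n f → ∑< (suc n) f ≡ ∑< n f +ℚ f n
∑<-last zero    f = trans (ℚ.+-identityʳ (f 0)) (sym (ℚ.+-identityˡ (f 0)))
∑<-last (suc n) f = trans (cong (f 0 +ℚ_) (∑<-last n (f ∘ suc))) (sym (ℚ.+-assoc (f 0) _ _))

∑<-split : ∀ a b f → ∑< (a + b) f ≡ ∑< a f +ℚ ∑< b (λ i → f (a + i))
∑<-split zero    b f = sym (ℚ.+-identityˡ _)
∑<-split (suc a) b f = trans (cong (f 0 +ℚ_) (∑<-split a b (f ∘ suc))) (sym (ℚ.+-assoc (f 0) _ _))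

∑<-reverse : ∀ n f → ∑< n f ≡ ∑< n (λ i → f (n ∸ suc i))
∑<-reverse zero    f = refl
∑<-reverse (suc n) f = begin
  f 0 +ℚ ∑< n (f ∘ suc)                      ≡⟨ cong (f 0 +ℚ_) (∑<-reverse n (f ∘ suc)) ⟩
  f 0 +ℚ ∑< n (λ i → f (suc (n ∸ suc i)))    ≡⟨ ℚ.+-comm (f 0) _ ⟩
  ∑< n (λ i → f (suc (n ∸ suc i))) +ℚ f 0    ≡⟨ cong₂ _+ℚ_
                                                   (∑<-cong n (λ i i<n → cong f (sym (ℕ.+-∸-assoc 1 i<n))))
                                                   (cong f (sym (ℕ.n∸n≡0 n))) ⟩
  ∑< n (λ i → f (n ∸ i)) +ℚ f (n ∸ n)        ≡⟨ sym (∑<-last n (λ i → f (n ∸ i))) ⟩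
  ∑< (suc n) (λ i → f (n ∸ i))               ∎

∑<-comm : ∀ a b (f : ℕ → ℕ → ℚ) →
          ∑< a (λ k → ∑< b (f k)) ≡ ∑< b (λ i → ∑< a (λ k → f k i))
∑<-comm zero    b f = sym (∑<-zero b (λ _ _ → refl))
∑<-comm (suc a) b f =
  trans (cong (∑< b (f 0) +ℚ_) (∑<-comm a b (f ∘ suc))) (sym (∑<-+ b (f 0) _))

∑<-zero-prefix : ∀ {a n} f → a ≤ n → (∀ k → k < a → f k ≡ 0ℚ) →
                 ∑< n f ≡ ∑< (n ∸ a) (λ i → f (a + i))
∑<-zero-prefix {a} {n} f a≤n f≡0 = begin
  ∑< n f                                   ≡⟨ cong (λ N → ∑< N f) (sym (ℕ.m+[n∸m]≡n a≤n)) ⟩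
  ∑< (a + (n ∸ a)) f                       ≡⟨ ∑<-split a (n ∸ a) f ⟩
  ∑< a f +ℚ ∑< (n ∸ a) (λ i → f (a + i))   ≡⟨ cong (_+ℚ ∑< (n ∸ a) (λ i → f (a + i))) (∑<-zero a f≡0) ⟩
  0ℚ +ℚ ∑< (n ∸ a) (λ i → f (a + i))       ≡⟨ ℚ.+-identityˡ _ ⟩
  ∑< (n ∸ a) (λ i → f (a + i))             ∎

∑<-zero-suffix : ∀ {b n} f → b ≤ n → (∀ k → b ≤ k → k < n → f k ≡ 0ℚ) → ∑< n f ≡ ∑< b f
∑<-zero-suffix {b} {n} f b≤n f≡0 = begin
  ∑< n f                                   ≡⟨ cong (λ N → ∑< N f) (sym (ℕ.m+[n∸m]≡n b≤n)) ⟩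
  ∑< (b + (n ∸ b)) f                       ≡⟨ ∑<-split b (n ∸ b) f ⟩
  ∑< b f +ℚ ∑< (n ∸ b) (λ i → f (b + i))   ≡⟨ cong (∑< b f +ℚ_) (∑<-zero (n ∸ b) tail≡0) ⟩
  ∑< b f +ℚ 0ℚ                             ≡⟨ ℚ.+-identityʳ _ ⟩
  ∑< b f                                   ∎
  where
  tail≡0 : ∀ i → i < n ∸ b → f (b + i) ≡ 0ℚ
  tail≡0 i i<n∸b = f≡0 (b + i) (ℕ.m≤m+n b i)
                       (subst (b + i <_) (ℕ.m+[n∸m]≡n b≤n) (ℕ.+-monoʳ-< b i<n∸b))

∑<-decimate : ∀ q .{{_ : NonZero q}} n g → (∀ k → k < q * n → q ∤ k → g k ≡ 0ℚ) →
              ∑< (q * n) g ≡ ∑< n (λ k → g (q * k))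
∑<-decimate q n g g≡0 = begin
  ∑< (q * n) g            ≡⟨ cong (λ N → ∑< N g) (ℕ.*-comm q n) ⟩
  ∑< (n * q) g            ≡⟨ blocks n g (λ k k<nq → g≡0 k (subst (k <_) (ℕ.*-comm n q) k<nq)) ⟩
  ∑< n (λ k → g (k * q))  ≡⟨ ∑<-cong n (λ k _ → cong g (ℕ.*-comm k q)) ⟩
  ∑< n (λ k → g (q * k))  ∎
  where
  first-block : ∀ q .{{_ : NonZero q}} g → (∀ i → 0 < i → i < q → g i ≡ 0ℚ) → ∑< q g ≡ g 0
  first-block (suc q) g g≡0 =
    trans (cong (g 0 +ℚ_) (∑<-zero q (λ i i<q → g≡0 (suc i) z<s (s≤s i<q)))) (ℚ.+-identityʳ (g 0))

  blocks : ∀ n g → (∀ k → k < n * q → q ∤ k → g k ≡ 0ℚ) →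
           ∑< (n * q) g ≡ ∑< n (λ k → g (k * q))
  blocks zero    g g≡0 = refl
  blocks (suc n) g g≡0 = begin
    ∑< (q + n * q) g                         ≡⟨ ∑<-split q (n * q) g ⟩
    ∑< q g +ℚ ∑< (n * q) (λ i → g (q + i))   ≡⟨ cong₂ _+ℚ_ (first-block q g inner≡0)
                                                           (blocks n (λ i → g (q + i)) later≡0) ⟩
    g 0 +ℚ ∑< n (λ k → g (q + k * q))        ∎
    where
    inner≡0 : ∀ i → 0 < i → i < q → g i ≡ 0ℚ
    inner≡0 i@(suc _) _ i<q = g≡0 i (ℕ.≤-trans i<q (ℕ.m≤m+n q (n * q))) (>⇒∤ i<q)
    later≡0 : ∀ k → k < n * q → q ∤ k → g (q + k) ≡ 0ℚ
    later≡0 k k<nq q∤k =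
      g≡0 (q + k) (ℕ.+-monoʳ-< q k<nq) (λ q∣q+k → q∤k (∣m+n∣m⇒∣n q∣q+k ∣-refl))

if-true : ∀ {b} {x y : ℚ} → b ≡ true → (if b then x else y) ≡ x
if-true refl = refl

if-false : ∀ {b} {x y : ℚ} → b ≡ false → (if b then x else y) ≡ y
if-false refl = refl

*-if : ∀ b x y → x *ℚ (if b then y else 0ℚ) ≡ (if b then x *ℚ y else 0ℚ)
*-if true  x y = refl
*-if false x y = ℚ.*-zeroʳ x

ofℕ≡mkℚ : ∀ n → ofℕ n ≡ mkℚ (+ n) 0 (Coprime.sym (Coprime.1-coprimeTo n))
ofℕ≡mkℚ n = ℚ.normalize-coprime (Coprime.sym (Coprime.1-coprimeTo n))

ofℕ-* : ∀ a b → ofℕ a *ℚ ofℕ b ≡ ofℕ (a * b)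
ofℕ-* a b rewrite ofℕ≡mkℚ a | ofℕ≡mkℚ b = ℚ./-cong (sym (ℤ.pos-* a b)) refl

ofℕ-*-1/ : ∀ n .{{_ : NonZero n}} → ofℕ n *ℚ (+ 1 / n) ≡ 1ℚ
ofℕ-*-1/ (suc n)
  rewrite ofℕ≡mkℚ (suc n) | ℚ.normalize-coprime {1} {n} (Coprime.1-coprimeTo (suc n)) =
  ℚ.*-inverseʳ (mkℚ (+ suc n) 0 (Coprime.sym (Coprime.1-coprimeTo (suc n))))

ofℕ[n!]*invFact : ∀ n → ofℕ (n !) *ℚ invFact n ≡ 1ℚ
ofℕ[n!]*invFact n = ofℕ-*-1/ (n !) {{n !≢0}}

ofℕ[n!]*[x*invFact] : ∀ n x → ofℕ (n !) *ℚ (x *ℚ invFact n) ≡ x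
ofℕ[n!]*[x*invFact] n x = begin
  ofℕ (n !) *ℚ (x *ℚ invFact n)
    ≡⟨ solve 3 (λ a x b → a :* (x :* b) := x :* (a :* b)) refl (ofℕ (n !)) x (invFact n) ⟩
  x *ℚ (ofℕ (n !) *ℚ invFact n)
    ≡⟨ cong (x *ℚ_) (ofℕ[n!]*invFact n) ⟩
  x *ℚ 1ℚ
    ≡⟨ ℚ.*-identityʳ x ⟩
  x ∎

binom≡[N!]*invFact*invFact : ∀ {N K} → K ≤ N →
                             binom N K ≡ ofℕ (N !) *ℚ (invFact K *ℚ invFact (N ∸ K))
binom≡[N!]*invFact*invFact {N} {K} K≤N = begin
  ofℕ (N C K)
    ≡⟨ sym (ℚ.*-identityʳ _) ⟩
  ofℕ (N C K) *ℚ (1ℚ *ℚ 1ℚ)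
    ≡⟨ cong (ofℕ (N C K) *ℚ_) (sym (cong₂ _*ℚ_ (ofℕ[n!]*invFact K) (ofℕ[n!]*invFact (N ∸ K)))) ⟩
  ofℕ (N C K) *ℚ ((ofℕ (K !) *ℚ invFact K) *ℚ (ofℕ ((N ∸ K) !) *ℚ invFact (N ∸ K)))
    ≡⟨ solve 5 (λ c a x b y → c :* ((a :* x) :* (b :* y)) := (c :* (a :* b)) :* (x :* y)) refl
               (ofℕ (N C K)) (ofℕ (K !)) (invFact K) (ofℕ ((N ∸ K) !)) (invFact (N ∸ K)) ⟩
  (ofℕ (N C K) *ℚ (ofℕ (K !) *ℚ ofℕ ((N ∸ K) !))) *ℚ (invFact K *ℚ invFact (N ∸ K))
    ≡⟨ cong (_*ℚ (invFact K *ℚ invFact (N ∸ K)))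
            (trans (cong (ofℕ (N C K) *ℚ_) (ofℕ-* (K !) ((N ∸ K) !))) (ofℕ-* (N C K) _)) ⟩
  ofℕ ((N C K) * (K ! * (N ∸ K) !)) *ℚ (invFact K *ℚ invFact (N ∸ K))
    ≡⟨ cong (λ x → ofℕ x *ℚ (invFact K *ℚ invFact (N ∸ K))) nCk*k![n∸k]!≡n! ⟩
  ofℕ (N !) *ℚ (invFact K *ℚ invFact (N ∸ K))
    ∎
  where
  instance _ = K !* (N ∸ K) !≢0
  nCk*k![n∸k]!≡n! : (N C K) * (K ! * (N ∸ K) !) ≡ N !
  nCk*k![n∸k]!≡n! =
    trans (cong (_* (K ! * (N ∸ K) !)) (nCk≡n!/k![n-k]! K≤N)) (m/n*n≡m (k![n∸k]!∣n! K≤N))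

neg1^-suc-* : ∀ {n j} → j ≤ n → neg1^ (suc n) *ℚ neg1^ j ≡ - neg1^ (n ∸ j)
neg1^-suc-* {n}     {zero}  _         = ℚ.*-identityʳ _
neg1^-suc-* {suc n} {suc j} (s≤s j≤n) =
  trans (solve 2 (λ x y → (:- (:- x)) :* (:- y) := (:- x) :* y) refl (neg1^ n) (neg1^ j))
        (neg1^-suc-* j≤n)

IsOGFInverseOf : (ℕ → ℚ) → (ℕ → ℚ) → Set
IsOGFInverseOf d c = ∀ n → ∑< (suc n) (λ k → c k *ℚ d (n ∸ k)) ≡ δ₀ n

IsEGFInverseOf⇒IsOGFInverseOf : ∀ {den W} → IsEGFInverseOf den W →
                                IsOGFInverseOf den (λ k → W k *ℚ invFact k)
IsEGFInverseOf⇒IsOGFInverseOf {den} {W} inv n =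
  trans (sym (Σ[⋯]≡∑< 0 n (λ k → (W k *ℚ invFact k) *ℚ den (n ∸ k)))) (inv n)

δ₀-* : ∀ q .{{_ : NonZero q}} n → δ₀ (q * n) ≡ δ₀ n
δ₀-* q       zero    = cong δ₀ (ℕ.*-zeroʳ q)
δ₀-* (suc q) (suc n) = refl

-- When q ∤ k, also q ∤ qn − k, so only the multiples of q contribute to the coefficient of t^{qn}.
IsOGFInverseOf-decimate : ∀ q .{{_ : NonZero q}} {d c} → (∀ j → q ∤ j → d j ≡ 0ℚ) →
                          IsOGFInverseOf d c → IsOGFInverseOf (λ j → d (q * j)) (λ k → c (q * k))
IsOGFInverseOf-decimate q {d} {c} d≡0 c∗d≡δ₀ n = begin
  ∑< (suc n) (λ k → c (q * k) *ℚ d (q * (n ∸ k)))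
    ≡⟨ ∑<-cong (suc n) (λ k _ → cong (λ j → c (q * k) *ℚ d j) (ℕ.*-distribˡ-∸ q n k)) ⟩
  ∑< (suc n) (λ k → g (q * k))
    ≡⟨ ∑<-last n (λ k → g (q * k)) ⟩
  ∑< n (λ k → g (q * k)) +ℚ g (q * n)
    ≡⟨ cong (_+ℚ g (q * n)) (sym (∑<-decimate q n g g≡0)) ⟩
  ∑< (q * n) g +ℚ g (q * n)
    ≡⟨ sym (∑<-last (q * n) g) ⟩
  ∑< (suc (q * n)) g
    ≡⟨ c∗d≡δ₀ (q * n) ⟩
  δ₀ (q * n)
    ≡⟨ δ₀-* q n ⟩
  δ₀ n
    ∎
  where
  g : ℕ → ℚ
  g k = c k *ℚ d (q * n ∸ k)
  g≡0 : ∀ k → k < q * n → q ∤ k → g k ≡ 0ℚ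
  g≡0 k k<qn q∤k = trans (cong (c k *ℚ_) (d≡0 (q * n ∸ k) q∤qn∸k)) (ℚ.*-zeroʳ (c k))
    where
    q∣[qn∸k]+k : q ∣ (q * n ∸ k) + k
    q∣[qn∸k]+k = subst (q ∣_) (sym (ℕ.m∸n+n≡m (ℕ.<⇒≤ k<qn))) (m∣m*n n)
    q∤qn∸k : q ∤ q * n ∸ k
    q∤qn∸k q∣qn∸k = q∤k (∣m+n∣m⇒∣n q∣[qn∸k]+k q∣qn∸k)

-- Toeplitz–Hessenberg determinants

sumℚ-tabulate-zero : ∀ {n} (f : Fin n → ℚ) → (∀ i → f i ≡ 0ℚ) → sumℚ (tabulate f) ≡ 0ℚ
sumℚ-tabulate-zero {zero}  f f≡0 = refl
sumℚ-tabulate-zero {suc n} f f≡0 =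
  trans (cong₂ _+ℚ_ (f≡0 fzero) (sumℚ-tabulate-zero (f ∘ fsuc) (f≡0 ∘ fsuc))) (ℚ.+-identityˡ 0ℚ)

-- The first column is shifted by s so that the family is closed under the two first-row minors
-- that survive the Laplace expansion (deleting column 0 or column 1).
record IsToeplitzHessenberg (e : ℕ → ℚ) (s : ℕ) {n : ℕ} (M : Fin n → Fin n → ℚ) : Set where
  field
    superdiagonal : ∀ i j → toℕ j ≡ suc (toℕ i) → M i j ≡ 1ℚ
    upper         : ∀ i j → suc (toℕ i) < toℕ j → M i j ≡ 0ℚ
    lower         : ∀ i j → toℕ j ≤ toℕ i → 1 ≤ toℕ j → M i j ≡ e (toℕ i ∸ toℕ j)
    first-column  : ∀ i j → toℕ j ≡ 0 → M i j ≡ e (s + toℕ i)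

hessenbergDet : (ℕ → ℚ) → ℕ → ℕ → ℚ
hessenbergDet e s zero          = 1ℚ
hessenbergDet e s (suc zero)    = e s
hessenbergDet e s (suc (suc n)) = e s *ℚ hessenbergDet e 0 (suc n) +ℚ - hessenbergDet e (suc s) (suc n)

module _ {e : ℕ → ℚ} {s n : ℕ} {M : Fin (suc (suc n)) → Fin (suc (suc n)) → ℚ}
         (H : IsToeplitzHessenberg e s M) where
  open IsToeplitzHessenberg H

  minor₀-isToeplitzHessenberg : IsToeplitzHessenberg e 0 (λ r c → M (fsuc r) (punchIn fzero c))
  minor₀-isToeplitzHessenberg = record
    { superdiagonal = λ i j eq → superdiagonal (fsuc i) (fsuc j) (cong suc eq)
    ; upper         = λ i j lt → upper (fsuc i) (fsuc j) (s≤s lt)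
    ; lower         = λ i j le _ → lower (fsuc i) (fsuc j) (s≤s le) (s≤s z≤n)
    ; first-column  = column₀
    }
    where
    column₀ : ∀ i j → toℕ j ≡ 0 → M (fsuc i) (fsuc j) ≡ e (toℕ i)
    column₀ i fzero _ = lower (fsuc i) (fsuc fzero) (s≤s z≤n) (s≤s z≤n)

  minor₁-isToeplitzHessenberg :
    IsToeplitzHessenberg e (suc s) (λ r c → M (fsuc r) (punchIn (fsuc fzero) c))
  minor₁-isToeplitzHessenberg = record
    { superdiagonal = superdiagonal₁
    ; upper         = upper₁
    ; lower         = lower₁
    ; first-column  = column₀
    }
    where
    M₁ : Fin (suc n) → Fin (suc n) → ℚ
    M₁ r c = M (fsuc r) (punchIn (fsuc fzero) c)
    superdiagonal₁ : ∀ i j → toℕ j ≡ suc (toℕ i) → M₁ i j ≡ 1ℚ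
    superdiagonal₁ i (fsuc j) eq = superdiagonal (fsuc i) (fsuc (fsuc j)) (cong suc eq)
    upper₁ : ∀ i j → suc (toℕ i) < toℕ j → M₁ i j ≡ 0ℚ
    upper₁ i (fsuc j) lt = upper (fsuc i) (fsuc (fsuc j)) (s≤s lt)
    lower₁ : ∀ i j → toℕ j ≤ toℕ i → 1 ≤ toℕ j → M₁ i j ≡ e (toℕ i ∸ toℕ j)
    lower₁ i (fsuc j) le _ = lower (fsuc i) (fsuc (fsuc j)) (s≤s le) (s≤s z≤n)
    column₀ : ∀ i j → toℕ j ≡ 0 → M₁ i j ≡ e (suc s + toℕ i)
    column₀ i fzero _ = trans (first-column (fsuc i) fzero refl) (cong e (ℕ.+-suc s (toℕ i)))

  private
    minor : Fin (suc (suc n)) → ℚ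
    minor j = det (suc n) (λ r c → M (fsuc r) (punchIn j c))
    cofactor : Fin (suc (suc n)) → ℚ
    cofactor j = neg1^ (toℕ j) *ℚ (M fzero j *ℚ minor j)

  det-toeplitzHessenberg-expand : ∀ {D₀ D₁} → minor fzero ≡ D₀ → minor (fsuc fzero) ≡ D₁ →
                                  det (suc (suc n)) M ≡ e s *ℚ D₀ +ℚ - D₁
  det-toeplitzHessenberg-expand {D₀} {D₁} minor₀≡D₀ minor₁≡D₁ = begin
    cofactor fzero +ℚ (cofactor (fsuc fzero) +ℚ sumℚ (map cofactor (tabulate (fsuc ∘ fsuc))))
      ≡⟨ cong₂ _+ℚ_ cofactor₀ (cong₂ _+ℚ_ cofactor₁ rest) ⟩
    e s *ℚ D₀ +ℚ (- D₁ +ℚ 0ℚ)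
      ≡⟨ cong (e s *ℚ D₀ +ℚ_) (ℚ.+-identityʳ (- D₁)) ⟩
    e s *ℚ D₀ +ℚ - D₁
      ∎
    where
    cofactor₀ : cofactor fzero ≡ e s *ℚ D₀
    cofactor₀ = trans (ℚ.*-identityˡ _)
      (cong₂ _*ℚ_ (trans (first-column fzero fzero refl) (cong e (ℕ.+-identityʳ s))) minor₀≡D₀)

    cofactor₁ : cofactor (fsuc fzero) ≡ - D₁
    cofactor₁ = begin
      (- 1ℚ) *ℚ (M fzero (fsuc fzero) *ℚ minor (fsuc fzero))
        ≡⟨ cong₂ (λ a b → (- 1ℚ) *ℚ (a *ℚ b)) (superdiagonal fzero (fsuc fzero) refl) minor₁≡D₁ ⟩
      (- 1ℚ) *ℚ (1ℚ *ℚ D₁)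
        ≡⟨ solve 1 (λ x → (:- con 1ℚ) :* (con 1ℚ :* x) := :- x) refl D₁ ⟩
      - D₁
        ∎

    rest : sumℚ (map cofactor (tabulate (fsuc ∘ fsuc))) ≡ 0ℚ
    rest = trans (cong sumℚ (map-tabulate (fsuc ∘ fsuc) cofactor)) (sumℚ-tabulate-zero _ cofactor≡0)
      where
      cofactor≡0 : ∀ x → cofactor (fsuc (fsuc x)) ≡ 0ℚ
      cofactor≡0 x = begin
        neg1^ (2 + toℕ x) *ℚ (M fzero (fsuc (fsuc x)) *ℚ minor (fsuc (fsuc x)))
          ≡⟨ cong (λ a → neg1^ (2 + toℕ x) *ℚ (a *ℚ minor (fsuc (fsuc x))))
                  (upper fzero (fsuc (fsuc x)) (s≤s (s≤s z≤n))) ⟩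
        neg1^ (2 + toℕ x) *ℚ (0ℚ *ℚ minor (fsuc (fsuc x)))
          ≡⟨ cong (neg1^ (2 + toℕ x) *ℚ_) (ℚ.*-zeroˡ (minor (fsuc (fsuc x)))) ⟩
        neg1^ (2 + toℕ x) *ℚ 0ℚ
          ≡⟨ ℚ.*-zeroʳ (neg1^ (2 + toℕ x)) ⟩
        0ℚ ∎

det≡hessenbergDet : ∀ {e s} n {M : Fin n → Fin n → ℚ} → IsToeplitzHessenberg e s M →
                    det n M ≡ hessenbergDet e s n
det≡hessenbergDet zero                     H = refl
det≡hessenbergDet {e} {s} (suc zero) {M} H = begin
  1ℚ *ℚ (M fzero fzero *ℚ 1ℚ) +ℚ 0ℚ
    ≡⟨ trans (ℚ.+-identityʳ _) (trans (ℚ.*-identityˡ _) (ℚ.*-identityʳ _)) ⟩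
  M fzero fzero
    ≡⟨ IsToeplitzHessenberg.first-column H fzero fzero refl ⟩
  e (s + 0)
    ≡⟨ cong e (ℕ.+-identityʳ s) ⟩
  e s ∎
det≡hessenbergDet (suc (suc n)) H = det-toeplitzHessenberg-expand H
  (det≡hessenbergDet (suc n) (minor₀-isToeplitzHessenberg H))
  (det≡hessenbergDet (suc n) (minor₁-isToeplitzHessenberg H))

hessenbergDet-expand : ∀ e n s → hessenbergDet e s (suc n)
                     ≡ ∑< (suc n) (λ j → neg1^ j *ℚ (e (s + j) *ℚ hessenbergDet e 0 (n ∸ j)))
hessenbergDet-expand e zero s = sym (begin
  1ℚ *ℚ (e (s + 0) *ℚ 1ℚ) +ℚ 0ℚ
    ≡⟨ trans (ℚ.+-identityʳ _) (trans (ℚ.*-identityˡ _) (ℚ.*-identityʳ _)) ⟩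
  e (s + 0)
    ≡⟨ cong e (ℕ.+-identityʳ s) ⟩
  e s ∎)
hessenbergDet-expand e (suc n) s = cong₂ _+ℚ_ first others
  where
  F : ℕ → ℚ
  F = hessenbergDet e 0
  first : e s *ℚ F (suc n) ≡ 1ℚ *ℚ (e (s + 0) *ℚ F (suc n))
  first = sym (trans (ℚ.*-identityˡ _) (cong (λ j → e j *ℚ F (suc n)) (ℕ.+-identityʳ s)))
  others : - hessenbergDet e (suc s) (suc n)
         ≡ ∑< (suc n) (λ j → neg1^ (suc j) *ℚ (e (s + suc j) *ℚ F (n ∸ j)))
  others = begin
    - hessenbergDet e (suc s) (suc n)
      ≡⟨ cong -_ (hessenbergDet-expand e n (suc s)) ⟩
    - ∑< (suc n) (λ j → neg1^ j *ℚ (e (suc s + j) *ℚ F (n ∸ j)))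
      ≡⟨ neg-distrib-∑< (suc n) (λ j → neg1^ j *ℚ (e (suc s + j) *ℚ F (n ∸ j))) ⟩
    ∑< (suc n) (λ j → - (neg1^ j *ℚ (e (suc s + j) *ℚ F (n ∸ j))))
      ≡⟨ ∑<-cong (suc n) (λ j _ → trans (ℚ.neg-distribˡ-* (neg1^ j) _)
           (cong (λ i → neg1^ (suc j) *ℚ (e i *ℚ F (n ∸ j))) (sym (ℕ.+-suc s j)))) ⟩
    ∑< (suc n) (λ j → neg1^ (suc j) *ℚ (e (s + suc j) *ℚ F (n ∸ j)))
      ∎

signedHessenbergDet-suc : ∀ e n → neg1^ (suc n) *ℚ hessenbergDet e 0 (suc n)
                        ≡ - ∑< (suc n) (λ j → e j *ℚ (neg1^ (n ∸ j) *ℚ hessenbergDet e 0 (n ∸ j)))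
signedHessenbergDet-suc e n = begin
  neg1^ (suc n) *ℚ F (suc n)
    ≡⟨ cong (neg1^ (suc n) *ℚ_) (hessenbergDet-expand e n 0) ⟩
  neg1^ (suc n) *ℚ ∑< (suc n) (λ j → neg1^ j *ℚ (e j *ℚ F (n ∸ j)))
    ≡⟨ *-distribˡ-∑< (suc n) (neg1^ (suc n)) (λ j → neg1^ j *ℚ (e j *ℚ F (n ∸ j))) ⟩
  ∑< (suc n) (λ j → neg1^ (suc n) *ℚ (neg1^ j *ℚ (e j *ℚ F (n ∸ j))))
    ≡⟨ ∑<-cong (suc n) (λ j j<1+n → sign j (ℕ.≤-pred j<1+n)) ⟩
  ∑< (suc n) (λ j → - (e j *ℚ (neg1^ (n ∸ j) *ℚ F (n ∸ j))))
    ≡⟨ sym (neg-distrib-∑< (suc n) (λ j → e j *ℚ (neg1^ (n ∸ j) *ℚ F (n ∸ j)))) ⟩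
  - ∑< (suc n) (λ j → e j *ℚ (neg1^ (n ∸ j) *ℚ F (n ∸ j)))
    ∎
  where
  F : ℕ → ℚ
  F = hessenbergDet e 0
  sign : ∀ j → j ≤ n → neg1^ (suc n) *ℚ (neg1^ j *ℚ (e j *ℚ F (n ∸ j)))
                     ≡ - (e j *ℚ (neg1^ (n ∸ j) *ℚ F (n ∸ j)))
  sign j j≤n = begin
    neg1^ (suc n) *ℚ (neg1^ j *ℚ (e j *ℚ F (n ∸ j)))
      ≡⟨ sym (ℚ.*-assoc (neg1^ (suc n)) (neg1^ j) (e j *ℚ F (n ∸ j))) ⟩
    (neg1^ (suc n) *ℚ neg1^ j) *ℚ (e j *ℚ F (n ∸ j))
      ≡⟨ cong (_*ℚ (e j *ℚ F (n ∸ j))) (neg1^-suc-* j≤n) ⟩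
    (- neg1^ (n ∸ j)) *ℚ (e j *ℚ F (n ∸ j))
      ≡⟨ solve 3 (λ σ x f → (:- σ) :* (x :* f) := :- (x :* (σ :* f))) refl
                 (neg1^ (n ∸ j)) (e j) (F (n ∸ j)) ⟩
    - (e j *ℚ (neg1^ (n ∸ j) *ℚ F (n ∸ j)))
      ∎

-- Weighted compositions

sumℚ-++ : ∀ xs ys → sumℚ (xs ++ ys) ≡ sumℚ xs +ℚ sumℚ ys
sumℚ-++ []       ys = sym (ℚ.+-identityˡ _)
sumℚ-++ (x ∷ xs) ys = trans (cong (x +ℚ_) (sumℚ-++ xs ys)) (sym (ℚ.+-assoc x _ _))

sumℚ-map-concatMap : ∀ {A B : Set} (h : A → ℚ) (f : B → List A) xs →
                     sumℚ (map h (concatMap f xs)) ≡ sumℚ (map (λ x → sumℚ (map h (f x))) xs)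
sumℚ-map-concatMap h f []       = refl
sumℚ-map-concatMap h f (x ∷ xs) = begin
  sumℚ (map h (f x ++ concatMap f xs))
    ≡⟨ cong sumℚ (map-++ h (f x) (concatMap f xs)) ⟩
  sumℚ (map h (f x) ++ map h (concatMap f xs))
    ≡⟨ sumℚ-++ (map h (f x)) (map h (concatMap f xs)) ⟩
  sumℚ (map h (f x)) +ℚ sumℚ (map h (concatMap f xs))
    ≡⟨ cong (sumℚ (map h (f x)) +ℚ_) (sumℚ-map-concatMap h f xs) ⟩
  sumℚ (map h (f x)) +ℚ sumℚ (map (λ x → sumℚ (map h (f x))) xs)
    ∎

sumℚ-map-filterᵇ : ∀ {A : Set} (p : A → Bool) (g : A → ℚ) xs →
                   sumℚ (map g (filterᵇ p xs)) ≡ sumℚ (map (λ x → if p x then g x else 0ℚ) xs)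
sumℚ-map-filterᵇ p g []       = refl
sumℚ-map-filterᵇ p g (x ∷ xs) with p x
... | true  = cong (g x +ℚ_) (sumℚ-map-filterᵇ p g xs)
... | false = trans (sumℚ-map-filterᵇ p g xs) (sym (ℚ.+-identityˡ _))

*-distribˡ-sumℚ : ∀ a xs → a *ℚ sumℚ xs ≡ sumℚ (map (a *ℚ_) xs)
*-distribˡ-sumℚ a []       = ℚ.*-zeroʳ a
*-distribˡ-sumℚ a (x ∷ xs) = trans (ℚ.*-distribˡ-+ a x _) (cong (a *ℚ x +ℚ_) (*-distribˡ-sumℚ a xs))

map-applyUpTo : ∀ {A : Set} (g : ℕ → A) f n → map g (applyUpTo f n) ≡ applyUpTo (g ∘ f) n
map-applyUpTo g f zero    = refl
map-applyUpTo g f (suc n) = cong (g (f 0) ∷_) (map-applyUpTo g (f ∘ suc) n)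

∏ : (ℕ → ℚ) → List ℕ → ℚ
∏ v = foldr (λ i q → v i *ℚ q) 1ℚ

∏-if : ∀ ok w xs → ∏ (λ i → if ok i then w i else 0ℚ) xs ≡ (if all ok xs then ∏ w xs else 0ℚ)
∏-if ok w []       = refl
∏-if ok w (x ∷ xs) with ok x
... | true  = trans (cong (w x *ℚ_) (∏-if ok w xs)) (*-if (all ok xs) (w x) (∏ w xs))
... | false = ℚ.*-zeroˡ (∏ (λ i → if ok i then w i else 0ℚ) xs)

weight : (ℕ → Bool) → ℕ → ℚ
weight ok i = if ok i then invFact (3 * i) else 0ℚ

compositionTerm : (ℕ → ℚ) → ℕ → List ℕ → ℚ
compositionTerm v n xs = if sum xs ≡ᵇ n then ∏ v xs else 0ℚ

compositionSum : (ℕ → ℚ) → ℕ → ℕ → ℕ → ℚ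
compositionSum v N n k = sumℚ (map (compositionTerm v n) (tuples k N))

compSum≡compositionSum : ∀ ok n k → compSum ok n k ≡ compositionSum (weight ok) n n k
compSum≡compositionSum ok n k = begin
  compSum ok n k
    ≡⟨ sumℚ-map-filterᵇ (λ xs → (sum xs ≡ᵇ n) ∧ all ok xs) (∏ w) (tuples k n) ⟩
  sumℚ (map (λ xs → if (sum xs ≡ᵇ n) ∧ all ok xs then ∏ w xs else 0ℚ) (tuples k n))
    ≡⟨ cong sumℚ (map-cong term≡ (tuples k n)) ⟩
  compositionSum (weight ok) n n k
    ∎
  where
  w : ℕ → ℚ
  w i = invFact (3 * i)
  term≡ : ∀ xs → (if (sum xs ≡ᵇ n) ∧ all ok xs then ∏ w xs else 0ℚ) ≡ compositionTerm (weight ok) n xs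
  term≡ xs with sum xs ≡ᵇ n
  ... | true  = sym (∏-if ok w xs)
  ... | false = refl

m+n≡ᵇo≡m≤ᵇo∧n≡ᵇo∸m : ∀ m n o → (m + n ≡ᵇ o) ≡ (m ≤ᵇ o) ∧ (n ≡ᵇ o ∸ m)
m+n≡ᵇo≡m≤ᵇo∧n≡ᵇo∸m zero    n o       = refl
m+n≡ᵇo≡m≤ᵇo∧n≡ᵇo∸m (suc m) n zero    = refl
m+n≡ᵇo≡m≤ᵇo∧n≡ᵇo∸m (suc m) n (suc o) =
  trans (m+n≡ᵇo≡m≤ᵇo∧n≡ᵇo∸m m n o) (cong (_∧ (n ≡ᵇ o ∸ m)) (sym (suc≤ᵇsuc m o)))
  where
  suc≤ᵇsuc : ∀ m o → (suc m ≤ᵇ suc o) ≡ (m ≤ᵇ o)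
  suc≤ᵇsuc zero    o = refl
  suc≤ᵇsuc (suc m) o = refl

compositionTerm-∷ : ∀ v n i xs → compositionTerm v n (i ∷ xs)
                  ≡ (if i ≤ᵇ n then v i else 0ℚ) *ℚ compositionTerm v (n ∸ i) xs
compositionTerm-∷ v n i xs rewrite m+n≡ᵇo≡m≤ᵇo∧n≡ᵇo∸m i (sum xs) n with i ≤ᵇ n
... | true  = sym (*-if (sum xs ≡ᵇ n ∸ i) (v i) (∏ v xs))
... | false = sym (ℚ.*-zeroˡ (compositionTerm v (n ∸ i) xs))

compositionSum-zero : ∀ v N n → compositionSum v N n 0 ≡ δ₀ n
compositionSum-zero v N zero    = ℚ.+-identityʳ 1ℚ
compositionSum-zero v N (suc n) = ℚ.+-identityʳ 0ℚ

compositionSum-suc : ∀ v N n k → compositionSum v N n (suc k)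
                   ≡ ∑< N (λ i → (if suc i ≤ᵇ n then v (suc i) else 0ℚ) *ℚ compositionSum v N (n ∸ suc i) k)
compositionSum-suc v N n k = begin
  sumℚ (map (compositionTerm v n) (concatMap (λ i → map (i ∷_) (tuples k N)) (applyUpTo suc N)))
    ≡⟨ sumℚ-map-concatMap (compositionTerm v n) (λ i → map (i ∷_) (tuples k N)) (applyUpTo suc N) ⟩
  sumℚ (map (λ i → sumℚ (map (compositionTerm v n) (map (i ∷_) (tuples k N)))) (applyUpTo suc N))
    ≡⟨ cong sumℚ (map-cong first-part (applyUpTo suc N)) ⟩
  sumℚ (map a (applyUpTo suc N))
    ≡⟨ cong sumℚ (map-applyUpTo a suc N) ⟩
  sumℚ (applyUpTo (a ∘ suc) N)
    ≡⟨ sumℚ-applyUpTo N (a ∘ suc) ⟩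
  ∑< N (a ∘ suc)
    ∎
  where
  vₙ : ℕ → ℚ
  vₙ i = if i ≤ᵇ n then v i else 0ℚ
  a : ℕ → ℚ
  a i = vₙ i *ℚ compositionSum v N (n ∸ i) k
  first-part : ∀ i → sumℚ (map (compositionTerm v n) (map (i ∷_) (tuples k N))) ≡ a i
  first-part i = begin
    sumℚ (map (compositionTerm v n) (map (i ∷_) (tuples k N)))
      ≡⟨ cong sumℚ (sym (map-∘ (tuples k N))) ⟩
    sumℚ (map (compositionTerm v n ∘ (i ∷_)) (tuples k N))
      ≡⟨ cong sumℚ (map-cong (compositionTerm-∷ v n i) (tuples k N)) ⟩
    sumℚ (map (λ xs → vₙ i *ℚ compositionTerm v (n ∸ i) xs) (tuples k N))
      ≡⟨ cong sumℚ (map-∘ (tuples k N)) ⟩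
    sumℚ (map (vₙ i *ℚ_) (map (compositionTerm v (n ∸ i)) (tuples k N)))
      ≡⟨ sym (*-distribˡ-sumℚ (vₙ i) (map (compositionTerm v (n ∸ i)) (tuples k N))) ⟩
    a i
      ∎

alternatingCompositionSum : (ℕ → ℚ) → ℕ → ℕ → ℕ → ℚ
alternatingCompositionSum v N K n = ∑< (suc K) (λ k → neg1^ k *ℚ compositionSum v N n k)

alternatingCompositionSum-suc : ∀ v N K n → alternatingCompositionSum v N (suc K) n
  ≡ δ₀ n +ℚ - ∑< N (λ i → (if suc i ≤ᵇ n then v (suc i) else 0ℚ)
                          *ℚ alternatingCompositionSum v N K (n ∸ suc i))
alternatingCompositionSum-suc v N K n =
  cong₂ _+ℚ_ (trans (ℚ.*-identityˡ _) (compositionSum-zero v N n)) (begin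
    ∑< (suc K) (λ k → neg1^ (suc k) *ℚ C n (suc k))
      ≡⟨ ∑<-cong (suc K) (λ k _ → sym (ℚ.neg-distribˡ-* (neg1^ k) (C n (suc k)))) ⟩
    ∑< (suc K) (λ k → - (neg1^ k *ℚ C n (suc k)))
      ≡⟨ sym (neg-distrib-∑< (suc K) (λ k → neg1^ k *ℚ C n (suc k))) ⟩
    - ∑< (suc K) (λ k → neg1^ k *ℚ C n (suc k))
      ≡⟨ cong -_ (∑<-cong (suc K) (λ k _ → expand k)) ⟩
    - ∑< (suc K) (λ k → ∑< N (λ i → a i *ℚ (neg1^ k *ℚ C (n ∸ suc i) k)))
      ≡⟨ cong -_ (∑<-comm (suc K) N (λ k i → a i *ℚ (neg1^ k *ℚ C (n ∸ suc i) k))) ⟩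
    - ∑< N (λ i → ∑< (suc K) (λ k → a i *ℚ (neg1^ k *ℚ C (n ∸ suc i) k)))
      ≡⟨ cong -_ (∑<-cong N (λ i _ →
           sym (*-distribˡ-∑< (suc K) (a i) (λ k → neg1^ k *ℚ C (n ∸ suc i) k)))) ⟩
    - ∑< N (λ i → a i *ℚ alternatingCompositionSum v N K (n ∸ suc i))
      ∎)
  where
  C : ℕ → ℕ → ℚ
  C = compositionSum v N
  a : ℕ → ℚ
  a i = if suc i ≤ᵇ n then v (suc i) else 0ℚ
  expand : ∀ k → neg1^ k *ℚ C n (suc k) ≡ ∑< N (λ i → a i *ℚ (neg1^ k *ℚ C (n ∸ suc i) k))
  expand k = begin
    neg1^ k *ℚ C n (suc k)
      ≡⟨ cong (neg1^ k *ℚ_) (compositionSum-suc v N n k) ⟩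
    neg1^ k *ℚ ∑< N (λ i → a i *ℚ C (n ∸ suc i) k)
      ≡⟨ *-distribˡ-∑< N (neg1^ k) (λ i → a i *ℚ C (n ∸ suc i) k) ⟩
    ∑< N (λ i → neg1^ k *ℚ (a i *ℚ C (n ∸ suc i) k))
      ≡⟨ ∑<-cong N (λ i _ → solve 3 (λ σ x c → σ :* (x :* c) := x :* (σ :* c)) refl
                                    (neg1^ k) (a i) (C (n ∸ suc i) k)) ⟩
    ∑< N (λ i → a i *ℚ (neg1^ k *ℚ C (n ∸ suc i) k))
      ∎

-- The inverse of 1 + Σ_{j≥1} v_j t^j

module OGFInverse {d c : ℕ → ℚ} (v : ℕ → ℚ) (d-zero : d 0 ≡ 1ℚ)
                  (d-suc : ∀ i → d (suc i) ≡ v (suc i)) (c∗d≡δ₀ : IsOGFInverseOf d c) where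

  c-zero : c 0 ≡ 1ℚ
  c-zero = begin
    c 0               ≡⟨ sym (ℚ.*-identityʳ (c 0)) ⟩
    c 0 *ℚ 1ℚ         ≡⟨ cong (c 0 *ℚ_) (sym d-zero) ⟩
    c 0 *ℚ d 0        ≡⟨ sym (ℚ.+-identityʳ _) ⟩
    c 0 *ℚ d 0 +ℚ 0ℚ  ≡⟨ c∗d≡δ₀ 0 ⟩
    1ℚ                ∎

  c-suc : ∀ n → c (suc n) ≡ - ∑< (suc n) (λ k → c k *ℚ v (suc n ∸ k))
  c-suc n = begin
    c (suc n)
      ≡⟨ inverseʳ-unique _ _ with-last-term ⟩
    - ∑< (suc n) (λ k → c k *ℚ d (suc n ∸ k))
      ≡⟨ cong -_ (∑<-cong (suc n) (λ k k<1+n → cong (c k *ℚ_) (d≡v (ℕ.≤-pred k<1+n)))) ⟩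
    - ∑< (suc n) (λ k → c k *ℚ v (suc n ∸ k))
      ∎
    where
    last-term : c (suc n) *ℚ d (suc n ∸ suc n) ≡ c (suc n)
    last-term = begin
      c (suc n) *ℚ d (suc n ∸ suc n)  ≡⟨ cong (λ j → c (suc n) *ℚ d j) (ℕ.n∸n≡0 n) ⟩
      c (suc n) *ℚ d 0                ≡⟨ cong (c (suc n) *ℚ_) d-zero ⟩
      c (suc n) *ℚ 1ℚ                 ≡⟨ ℚ.*-identityʳ (c (suc n)) ⟩
      c (suc n)                       ∎
    with-last-term : ∑< (suc n) (λ k → c k *ℚ d (suc n ∸ k)) +ℚ c (suc n) ≡ 0ℚ
    with-last-term = begin
      ∑< (suc n) (λ k → c k *ℚ d (suc n ∸ k)) +ℚ c (suc n)
        ≡⟨ cong (∑< (suc n) (λ k → c k *ℚ d (suc n ∸ k)) +ℚ_) (sym last-term) ⟩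
      ∑< (suc n) (λ k → c k *ℚ d (suc n ∸ k)) +ℚ c (suc n) *ℚ d (suc n ∸ suc n)
        ≡⟨ sym (∑<-last (suc n) (λ k → c k *ℚ d (suc n ∸ k))) ⟩
      ∑< (suc (suc n)) (λ k → c k *ℚ d (suc n ∸ k))
        ≡⟨ c∗d≡δ₀ (suc n) ⟩
      0ℚ ∎
    d≡v : ∀ {k} → k ≤ n → d (suc n ∸ k) ≡ v (suc n ∸ k)
    d≡v {k} k≤n = begin
      d (suc n ∸ k)    ≡⟨ cong d (ℕ.+-∸-assoc 1 k≤n) ⟩
      d (suc (n ∸ k))  ≡⟨ d-suc (n ∸ k) ⟩
      v (suc (n ∸ k))  ≡⟨ cong v (sym (ℕ.+-∸-assoc 1 k≤n)) ⟩
      v (suc n ∸ k)    ∎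

  c-suc′ : ∀ n → c (suc n) ≡ - ∑< (suc n) (λ j → v (suc j) *ℚ c (n ∸ j))
  c-suc′ n = trans (c-suc n) (cong -_ (trans (∑<-reverse (suc n) (λ k → c k *ℚ v (suc n ∸ k)))
                                              (∑<-cong (suc n) reindex)))
    where
    reindex : ∀ j → j < suc n → c (n ∸ j) *ℚ v (suc n ∸ (n ∸ j)) ≡ v (suc j) *ℚ c (n ∸ j)
    reindex j j<1+n = begin
      c (n ∸ j) *ℚ v (suc n ∸ (n ∸ j))
        ≡⟨ cong (λ i → c (n ∸ j) *ℚ v i) (ℕ.+-∸-assoc 1 (ℕ.m∸n≤m n j)) ⟩
      c (n ∸ j) *ℚ v (suc (n ∸ (n ∸ j)))
        ≡⟨ cong (λ i → c (n ∸ j) *ℚ v (suc i)) (ℕ.m∸[m∸n]≡n (ℕ.≤-pred j<1+n)) ⟩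
      c (n ∸ j) *ℚ v (suc j)
        ≡⟨ ℚ.*-comm (c (n ∸ j)) (v (suc j)) ⟩
      v (suc j) *ℚ c (n ∸ j)
        ∎

  OGFInverse-unique : ∀ {c′ : ℕ → ℚ} → c′ 0 ≡ 1ℚ →
                      (∀ n → c′ (suc n) ≡ - ∑< (suc n) (λ j → v (suc j) *ℚ c′ (n ∸ j))) →
                      ∀ n → c′ n ≡ c n
  OGFInverse-unique {c′} c′-zero c′-suc = <-rec (λ n → c′ n ≡ c n) step
    where
    step : ∀ n → (∀ {k} → k < n → c′ k ≡ c k) → c′ n ≡ c n
    step zero    _  = trans c′-zero (sym c-zero)
    step (suc n) ih = begin
      c′ (suc n)
        ≡⟨ c′-suc n ⟩
      - ∑< (suc n) (λ j → v (suc j) *ℚ c′ (n ∸ j))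
        ≡⟨ cong -_ (∑<-cong (suc n) (λ j _ → cong (v (suc j) *ℚ_) (ih (s≤s (ℕ.m∸n≤m n j))))) ⟩
      - ∑< (suc n) (λ j → v (suc j) *ℚ c (n ∸ j))
        ≡⟨ sym (c-suc′ n) ⟩
      c (suc n)
        ∎

  c≡signedHessenbergDet : ∀ n → c n ≡ neg1^ n *ℚ hessenbergDet (v ∘ suc) 0 n
  c≡signedHessenbergDet n =
    sym (OGFInverse-unique (ℚ.*-identityˡ 1ℚ) (signedHessenbergDet-suc (v ∘ suc)) n)

  -- Truncating Σ_k (−x)^k at K ≥ n, and the parts at N ≥ n, leaves the coefficient of tⁿ unchanged.
  alternatingCompositionSum≡c : ∀ n N K → n ≤ N → n ≤ K → alternatingCompositionSum v N K n ≡ c n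
  alternatingCompositionSum≡c =
    <-rec (λ n → ∀ N K → n ≤ N → n ≤ K → alternatingCompositionSum v N K n ≡ c n) step
    where
    step : ∀ n → (∀ {n′} → n′ < n → ∀ N K → n′ ≤ N → n′ ≤ K →
                                     alternatingCompositionSum v N K n′ ≡ c n′) →
           ∀ N K → n ≤ N → n ≤ K → alternatingCompositionSum v N K n ≡ c n
    step zero    ih N zero    _   _ =
      trans (ℚ.+-identityʳ _) (trans (ℚ.*-identityˡ _) (trans (compositionSum-zero v N 0) (sym c-zero)))
    step (suc n) ih N zero    _   ()
    step n       ih N (suc K) n≤N n≤1+K = begin
      alternatingCompositionSum v N (suc K) n
        ≡⟨ alternatingCompositionSum-suc v N K n ⟩
      δ₀ n +ℚ - ∑< N G
        ≡⟨ cong (λ x → δ₀ n +ℚ - x) (∑<-zero-suffix G n≤N G≡0) ⟩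
      δ₀ n +ℚ - ∑< n G
        ≡⟨ cong (λ x → δ₀ n +ℚ - x) (∑<-cong n G≡) ⟩
      δ₀ n +ℚ - ∑< n (λ i → v (suc i) *ℚ c (n ∸ suc i))
        ≡⟨ δ₀-∑≡c n ⟩
      c n
        ∎
      where
      A : ℕ → ℚ
      A = alternatingCompositionSum v N K
      G : ℕ → ℚ
      G i = (if suc i ≤ᵇ n then v (suc i) else 0ℚ) *ℚ A (n ∸ suc i)
      G≡0 : ∀ i → n ≤ i → i < N → G i ≡ 0ℚ
      G≡0 i n≤i _ =
        trans (cong (_*ℚ A (n ∸ suc i)) (if-false (dec-false (suc i ≤? n) (ℕ.<⇒≱ (s≤s n≤i)))))
              (ℚ.*-zeroˡ (A (n ∸ suc i)))
      G≡ : ∀ i → i < n → G i ≡ v (suc i) *ℚ c (n ∸ suc i)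
      G≡ i i<n = cong₂ _*ℚ_ (if-true (dec-true (suc i ≤? n) i<n))
                            (ih (ℕ.∸-monoʳ-< z<s i<n) N K (ℕ.≤-trans (ℕ.m∸n≤m n (suc i)) n≤N)
                                (ℕ.≤-trans (ℕ.∸-monoˡ-≤ (suc i) n≤1+K) (ℕ.m∸n≤m K i)))
      δ₀-∑≡c : ∀ n → δ₀ n +ℚ - ∑< n (λ i → v (suc i) *ℚ c (n ∸ suc i)) ≡ c n
      δ₀-∑≡c zero    = sym c-zero
      δ₀-∑≡c (suc n) = trans (ℚ.+-identityˡ _) (sym (c-suc′ n))

  c≡compositions : ∀ n → 1 ≤ n → c n ≡ Σ[ 1 ⋯ n ] (λ k → neg1^ k *ℚ compositionSum v n n k)
  c≡compositions (suc n) _ = begin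
    c (suc n)
      ≡⟨ sym (alternatingCompositionSum≡c (suc n) (suc n) (suc n) ℕ.≤-refl ℕ.≤-refl) ⟩
    neg1^ 0 *ℚ C 0 +ℚ ∑< (suc n) (λ k → neg1^ (suc k) *ℚ C (suc k))
      ≡⟨ cong (_+ℚ ∑< (suc n) (λ k → neg1^ (suc k) *ℚ C (suc k)))
              (trans (ℚ.*-identityˡ (C 0)) (compositionSum-zero v (suc n) (suc n))) ⟩
    0ℚ +ℚ ∑< (suc n) (λ k → neg1^ (suc k) *ℚ C (suc k))
      ≡⟨ ℚ.+-identityˡ _ ⟩
    ∑< (suc n) (λ k → neg1^ (suc k) *ℚ C (suc k))
      ≡⟨ sym (Σ[⋯]≡∑< 1 (suc n) (λ k → neg1^ k *ℚ C k)) ⟩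
    Σ[ 1 ⋯ suc n ] (λ k → neg1^ k *ℚ C k)
      ∎
    where
    C : ℕ → ℚ
    C = compositionSum v (suc n) (suc n)

module IncompleteLehmerEuler (ok : ℕ → Bool) {den W : ℕ → ℚ}
  (den≡0 : ∀ j → 3 ∤ j → den j ≡ 0ℚ) (den-zero : den 0 ≡ 1ℚ)
  (den-suc : ∀ l → den (3 * suc l) ≡ weight ok (suc l)) (inv : IsEGFInverseOf den W) where

  c : ℕ → ℚ
  c k = W (3 * k) *ℚ invFact (3 * k)

  open OGFInverse {d = λ j → den (3 * j)} {c = c} (weight ok) den-zero den-suc
    (IsOGFInverseOf-decimate 3 {den} {λ k → W k *ℚ invFact k} den≡0
                             (IsEGFInverseOf⇒IsOGFInverseOf {den} {W} inv))

  W≡[3n]!*c : ∀ n → W (3 * n) ≡ ofℕ ((3 * n) !) *ℚ c n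
  W≡[3n]!*c n = sym (ofℕ[n!]*[x*invFact] (3 * n) (W (3 * n)))

  W-zero : W 0 ≡ 1ℚ
  W-zero = trans (sym (ℚ.*-identityʳ (W 0))) c-zero

  W-recurrence : ∀ n → W (3 * suc n)
               ≡ - ∑< (suc n) (λ k → if ok (suc n ∸ k) then binom (3 * suc n) (3 * k) *ℚ W (3 * k) else 0ℚ)
  W-recurrence n = begin
    W (3 * suc n)
      ≡⟨ W≡[3n]!*c (suc n) ⟩
    N! *ℚ c (suc n)
      ≡⟨ cong (N! *ℚ_) (c-suc n) ⟩
    N! *ℚ - ∑< (suc n) (λ k → c k *ℚ weight ok (suc n ∸ k))
      ≡⟨ sym (ℚ.neg-distribʳ-* N! _) ⟩
    - (N! *ℚ ∑< (suc n) (λ k → c k *ℚ weight ok (suc n ∸ k)))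
      ≡⟨ cong -_ (*-distribˡ-∑< (suc n) N! (λ k → c k *ℚ weight ok (suc n ∸ k))) ⟩
    - ∑< (suc n) (λ k → N! *ℚ (c k *ℚ weight ok (suc n ∸ k)))
      ≡⟨ cong -_ (∑<-cong (suc n) (λ k k<1+n → term k (ℕ.≤-pred k<1+n))) ⟩
    - ∑< (suc n) (λ k → if ok (suc n ∸ k) then binom (3 * suc n) (3 * k) *ℚ W (3 * k) else 0ℚ)
      ∎
    where
    N! : ℚ
    N! = ofℕ ((3 * suc n) !)
    term : ∀ k → k ≤ n → N! *ℚ (c k *ℚ weight ok (suc n ∸ k))
                       ≡ (if ok (suc n ∸ k) then binom (3 * suc n) (3 * k) *ℚ W (3 * k) else 0ℚ)
    term k k≤n = begin
      N! *ℚ (c k *ℚ weight ok (suc n ∸ k))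
        ≡⟨ cong (N! *ℚ_) (*-if (ok (suc n ∸ k)) (c k) (invFact (3 * (suc n ∸ k)))) ⟩
      N! *ℚ (if ok (suc n ∸ k) then c k *ℚ invFact (3 * (suc n ∸ k)) else 0ℚ)
        ≡⟨ *-if (ok (suc n ∸ k)) N! _ ⟩
      (if ok (suc n ∸ k) then N! *ℚ (c k *ℚ invFact (3 * (suc n ∸ k))) else 0ℚ)
        ≡⟨ cong (λ x → if ok (suc n ∸ k) then x else 0ℚ) binomial ⟩
      (if ok (suc n ∸ k) then binom (3 * suc n) (3 * k) *ℚ W (3 * k) else 0ℚ)
        ∎
      where
      binomial : N! *ℚ (c k *ℚ invFact (3 * (suc n ∸ k))) ≡ binom (3 * suc n) (3 * k) *ℚ W (3 * k)
      binomial = begin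
        N! *ℚ ((W (3 * k) *ℚ invFact (3 * k)) *ℚ invFact (3 * (suc n ∸ k)))
          ≡⟨ cong (λ j → N! *ℚ ((W (3 * k) *ℚ invFact (3 * k)) *ℚ invFact j))
                  (ℕ.*-distribˡ-∸ 3 (suc n) k) ⟩
        N! *ℚ ((W (3 * k) *ℚ invFact (3 * k)) *ℚ invFact (3 * suc n ∸ 3 * k))
          ≡⟨ solve 4 (λ a w x y → a :* ((w :* x) :* y) := (a :* (x :* y)) :* w) refl
                     N! (W (3 * k)) (invFact (3 * k)) (invFact (3 * suc n ∸ 3 * k)) ⟩
        (N! *ℚ (invFact (3 * k) *ℚ invFact (3 * suc n ∸ 3 * k))) *ℚ W (3 * k)
          ≡⟨ cong (_*ℚ W (3 * k))
                  (sym (binom≡[N!]*invFact*invFact (ℕ.*-monoʳ-≤ 3 (ℕ.m≤n⇒m≤1+n k≤n)))) ⟩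
        binom (3 * suc n) (3 * k) *ℚ W (3 * k)
          ∎

  W-compositions : ∀ n → 1 ≤ n →
                   W (3 * n) ≡ ofℕ ((3 * n) !) *ℚ Σ[ 1 ⋯ n ] (λ k → neg1^ k *ℚ compSum ok n k)
  W-compositions n 1≤n = begin
    W (3 * n)
      ≡⟨ W≡[3n]!*c n ⟩
    ofℕ ((3 * n) !) *ℚ c n
      ≡⟨ cong (ofℕ ((3 * n) !) *ℚ_) (c≡compositions n 1≤n) ⟩
    ofℕ ((3 * n) !) *ℚ Σ[ 1 ⋯ n ] (λ k → neg1^ k *ℚ compositionSum (weight ok) n n k)
      ≡⟨ cong (ofℕ ((3 * n) !) *ℚ_)
              (Σ[⋯]-cong 1 n (λ k → cong (neg1^ k *ℚ_) (sym (compSum≡compositionSum ok n k)))) ⟩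
    ofℕ ((3 * n) !) *ℚ Σ[ 1 ⋯ n ] (λ k → neg1^ k *ℚ compSum ok n k)
      ∎

  W-det : ∀ n {M : Fin n → Fin n → ℚ} → IsToeplitzHessenberg (weight ok ∘ suc) 0 M →
          W (3 * n) ≡ neg1^ n *ℚ (ofℕ ((3 * n) !) *ℚ det n M)
  W-det n {M} H = begin
    W (3 * n)
      ≡⟨ W≡[3n]!*c n ⟩
    ofℕ ((3 * n) !) *ℚ c n
      ≡⟨ cong (ofℕ ((3 * n) !) *ℚ_) (c≡signedHessenbergDet n) ⟩
    ofℕ ((3 * n) !) *ℚ (neg1^ n *ℚ hessenbergDet (weight ok ∘ suc) 0 n)
      ≡⟨ cong (λ x → ofℕ ((3 * n) !) *ℚ (neg1^ n *ℚ x)) (sym (det≡hessenbergDet n H)) ⟩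
    ofℕ ((3 * n) !) *ℚ (neg1^ n *ℚ det n M)
      ≡⟨ solve 3 (λ a σ x → a :* (σ :* x) := σ :* (a :* x)) refl (ofℕ ((3 * n) !)) (neg1^ n) (det n M) ⟩
    neg1^ n *ℚ (ofℕ ((3 * n) !) *ℚ det n M)
      ∎

[3*n]%3≡0 : ∀ n → (3 * n) % 3 ≡ 0
[3*n]%3≡0 n = trans (cong (_% 3) (ℕ.*-comm 3 n)) (m*n%n≡0 n 3)

[3*n]div3≡n : ∀ n → (3 * n) div 3 ≡ n
[3*n]div3≡n n = trans (cong (_div 3) (ℕ.*-comm 3 n)) (m*n/n≡m n 3)

[n%3≡ᵇ0]≡false : ∀ {n} → 3 ∤ n → (n % 3 ≡ᵇ 0) ≡ false
[n%3≡ᵇ0]≡false {n} 3∤n = dec-false (n % 3 ≟ 0) (3∤n ∘ m%n≡0⇒n∣m n 3)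

denLe≡0 : ∀ m j → 3 ∤ j → denLe m j ≡ 0ℚ
denLe≡0 m j 3∤j = if-false (cong (_∧ (j div 3 ≤ᵇ m)) ([n%3≡ᵇ0]≡false 3∤j))

denGe≡0 : ∀ m j → 3 ∤ j → denGe m j ≡ 0ℚ
denGe≡0 m j 3∤j = if-false (cong₂ (λ x y → x ∨ (y ∧ (m ≤ᵇ j div 3)))
  (dec-false (j ≟ 0) (λ j≡0 → 3∤j (subst (3 ∣_) (sym j≡0) (3 ∣0))))
  ([n%3≡ᵇ0]≡false 3∤j))

denLe-suc : ∀ m l → denLe m (3 * suc l) ≡ weight (λ i → i ≤ᵇ m) (suc l)
denLe-suc m l = cong₂ (λ r q → if (r ≡ᵇ 0) ∧ (q ≤ᵇ m) then invFact (3 * suc l) else 0ℚ)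
                      ([3*n]%3≡0 (suc l)) ([3*n]div3≡n (suc l))

denGe-suc : ∀ m l → denGe m (3 * suc l) ≡ weight (λ i → m ≤ᵇ i) (suc l)
denGe-suc m l =
  cong₂ (λ r q → if (3 * suc l ≡ᵇ 0) ∨ ((r ≡ᵇ 0) ∧ (m ≤ᵇ q)) then invFact (3 * suc l) else 0ℚ)
        ([3*n]%3≡0 (suc l)) ([3*n]div3≡n (suc l))

module WLe {m : ℕ} {W : ℕ → ℚ} (inv : IsWLe m W) =
  IncompleteLehmerEuler (λ i → i ≤ᵇ m) {W = W} (denLe≡0 m) refl (denLe-suc m) inv

module WGe {m : ℕ} {W : ℕ → ℚ} (inv : IsWGe m W) =
  IncompleteLehmerEuler (λ i → m ≤ᵇ i) {W = W} (denGe≡0 m) refl (denGe-suc m) inv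

-- matA m n and matB m n unfold to this matrix for ok = (_≤ᵇ m) and ok = (m ≤ᵇ_).
hessenbergEntry : (ℕ → Bool) → ℕ → ℕ → ℚ
hessenbergEntry ok i j =
  if j ≡ᵇ suc i then 1ℚ
  else if (j ≤ᵇ i) ∧ ok (suc (i ∸ j)) then invFact (3 * suc (i ∸ j))
  else 0ℚ

hessenbergEntry-isToeplitzHessenberg : ∀ ok n →
  IsToeplitzHessenberg (weight ok ∘ suc) 0 {n} (λ i j → hessenbergEntry ok (toℕ i) (toℕ j))
hessenbergEntry-isToeplitzHessenberg ok n = record
  { superdiagonal = λ i j → superdiagonal (toℕ i) (toℕ j)
  ; upper         = λ i j → upper (toℕ i) (toℕ j)
  ; lower         = λ i j j≤i _ → lower (toℕ i) (toℕ j) j≤i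
  ; first-column  = λ i j j≡0 → subst (λ b → hessenbergEntry ok (toℕ i) b ≡ weight ok (suc (toℕ i)))
                                      (sym j≡0) refl
  }
  where
  superdiagonal : ∀ i j → j ≡ suc i → hessenbergEntry ok i j ≡ 1ℚ
  superdiagonal i j j≡1+i = if-true (dec-true (j ≟ suc i) j≡1+i)
  upper : ∀ i j → suc i < j → hessenbergEntry ok i j ≡ 0ℚ
  upper i j 1+i<j = trans (if-false (dec-false (j ≟ suc i) (λ j≡1+i → ℕ.<-irrefl (sym j≡1+i) 1+i<j)))
                          (if-false (cong (_∧ ok (suc (i ∸ j)))
                                          (dec-false (j ≤? i) (ℕ.<⇒≱ (ℕ.<-trans (ℕ.n<1+n i) 1+i<j)))))
  lower : ∀ i j → j ≤ i → hessenbergEntry ok i j ≡ weight ok (suc (i ∸ j))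
  lower i j j≤i = trans (if-false (dec-false (j ≟ suc i) (ℕ.<⇒≱ (ℕ.n<1+n i) ∘ λ j≡1+i → subst (_≤ i) j≡1+i j≤i)))
                        (cong (λ b → if b ∧ ok (suc (i ∸ j)) then invFact (3 * suc (i ∸ j)) else 0ℚ)
                              (dec-true (j ≤? i) j≤i))

m∸n≤o⇒m∸o≤n : ∀ {m n o} → m ∸ n ≤ o → m ∸ o ≤ n
m∸n≤o⇒m∸o≤n {m} {n} {o} m∸n≤o = ℕ.m≤n+o⇒m∸n≤o m o
  (subst (m ≤_) (ℕ.+-comm n o) (ℕ.≤-trans (ℕ.m≤n+m∸n m n) (ℕ.+-monoʳ-≤ n m∸n≤o)))

m≤o∸n⇒n≤o∸m : ∀ {m n o} → n ≤ o → m ≤ o ∸ n → n ≤ o ∸ m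
m≤o∸n⇒n≤o∸m {m} {n} {o} n≤o m≤o∸n =
  ℕ.m+n≤o⇒m≤o∸n n (subst (_≤ o) (ℕ.+-comm m n) (ℕ.m≤o∸n⇒m+n≤o m n≤o m≤o∸n))

WLe-recurrence : ∀ {m W} → IsWLe m W →
  ∀ n → 1 ≤ n → W (3 * n) ≡ - Σ[ n ∸ m ⋯ n ∸ 1 ] (λ k → binom (3 * n) (3 * k) *ℚ W (3 * k))
WLe-recurrence {m} {W} inv (suc n) _ = begin
  W (3 * suc n)                       ≡⟨ WLe.W-recurrence {m} {W} inv n ⟩
  - ∑< (suc n) f                      ≡⟨ cong -_ (∑<-zero-prefix f (ℕ.m∸n≤m (suc n) m) f≡0) ⟩
  - ∑< (suc n ∸ a) (λ i → f (a + i))  ≡⟨ cong -_ (∑<-cong (suc n ∸ a) (λ i _ → f≡g (a + i) (ℕ.m≤m+n a i))) ⟩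
  - ∑< (suc n ∸ a) (λ i → g (a + i))  ≡⟨ cong -_ (sym (Σ[⋯]≡∑< a n g)) ⟩
  - Σ[ a ⋯ n ] g                      ∎
  where
  a : ℕ
  a = suc n ∸ m
  g f : ℕ → ℚ
  g k = binom (3 * suc n) (3 * k) *ℚ W (3 * k)
  f k = if suc n ∸ k ≤ᵇ m then g k else 0ℚ
  f≡0 : ∀ k → k < a → f k ≡ 0ℚ
  f≡0 k k<a = if-false (dec-false (suc n ∸ k ≤? m) (ℕ.<⇒≱ k<a ∘ m∸n≤o⇒m∸o≤n))
  f≡g : ∀ k → a ≤ k → f k ≡ g k
  f≡g k a≤k = if-true (dec-true (suc n ∸ k ≤? m) (m∸n≤o⇒m∸o≤n a≤k))

WGe-vanishes : ∀ {m V} → IsWGe m V → ∀ j → 1 ≤ j → j ≤ m ∸ 1 → V (3 * j) ≡ 0ℚ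
WGe-vanishes {suc m} {V} inv (suc j) _ j<m = begin
  V (3 * suc j)   ≡⟨ WGe.W-recurrence {suc m} {V} inv j ⟩
  - ∑< (suc j) f  ≡⟨ cong -_ (∑<-zero (suc j) (λ k _ → f≡0 k)) ⟩
  - 0ℚ            ≡⟨⟩
  0ℚ              ∎
  where
  f : ℕ → ℚ
  f k = if suc m ≤ᵇ suc j ∸ k then binom (3 * suc j) (3 * k) *ℚ V (3 * k) else 0ℚ
  f≡0 : ∀ k → f k ≡ 0ℚ
  f≡0 k = if-false (dec-false (suc m ≤? suc j ∸ k)
                              (ℕ.<⇒≱ (s≤s (ℕ.≤-trans (ℕ.m∸n≤m (suc j) k) j<m))))

WGe-recurrence : ∀ {m V} → 1 ≤ m → IsWGe m V →
  ∀ n → m ≤ n → V (3 * n) ≡ - Σ[ 0 ⋯ n ∸ m ] (λ k → binom (3 * n) (3 * k) *ℚ V (3 * k))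
WGe-recurrence         1≤m inv zero    m≤0 = contradiction (ℕ.≤-trans 1≤m m≤0) λ ()
WGe-recurrence {m} {V} 1≤m inv (suc n) m≤n = begin
  V (3 * suc n)           ≡⟨ WGe.W-recurrence {m} {V} inv n ⟩
  - ∑< (suc n) f          ≡⟨ cong -_ (∑<-zero-suffix f (s≤s (ℕ.∸-monoʳ-≤ (suc n) 1≤m)) f≡0) ⟩
  - ∑< b f                ≡⟨ cong -_ (∑<-cong b (λ k k<b → f≡g k (ℕ.≤-pred k<b))) ⟩
  - ∑< b g                ≡⟨ cong -_ (sym (Σ[⋯]≡∑< 0 (suc n ∸ m) g)) ⟩
  - Σ[ 0 ⋯ suc n ∸ m ] g  ∎
  where
  b : ℕ
  b = suc (suc n ∸ m)
  g f : ℕ → ℚ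
  g k = binom (3 * suc n) (3 * k) *ℚ V (3 * k)
  f k = if m ≤ᵇ suc n ∸ k then g k else 0ℚ
  f≡0 : ∀ k → b ≤ k → k < suc n → f k ≡ 0ℚ
  f≡0 k b≤k k<1+n = if-false (dec-false (m ≤? suc n ∸ k) (ℕ.<⇒≱ b≤k ∘ m≤o∸n⇒n≤o∸m (ℕ.<⇒≤ k<1+n)))
  f≡g : ∀ k → k ≤ suc n ∸ m → f k ≡ g k
  f≡g k k≤1+n∸m = if-true (dec-true (m ≤? suc n ∸ k) (m≤o∸n⇒n≤o∸m m≤n k≤1+n∸m))

proposition3 : ∀ (m : ℕ) → 1 ≤ m → (W V : ℕ → ℚ) → IsWLe m W → IsWGe m V →
    -- (i)(a)
    (W 0 ≡ 1ℚ
      × (∀ n → 1 ≤ n → W (3 * n) ≡ - Σ[ n ∸ m ⋯ n ∸ 1 ] (λ k → binom (3 * n) (3 * k) *ℚ W (3 * k))))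
    -- (i)(b)
    × (V 0 ≡ 1ℚ
      × (∀ j → 1 ≤ j → j ≤ m ∸ 1 → V (3 * j) ≡ 0ℚ)
      × (∀ n → m ≤ n → V (3 * n) ≡ - Σ[ 0 ⋯ n ∸ m ] (λ k → binom (3 * n) (3 * k) *ℚ V (3 * k))))
    -- (ii)
    × (∀ n → 1 ≤ n → W (3 * n) ≡ ofℕ ((3 * n) !) *ℚ Σ[ 1 ⋯ n ] (λ k → neg1^ k *ℚ compSum (λ i → i ≤ᵇ m) n k))
    × (∀ n → 1 ≤ n → V (3 * n) ≡ ofℕ ((3 * n) !) *ℚ Σ[ 1 ⋯ n ] (λ k → neg1^ k *ℚ compSum (λ i → m ≤ᵇ i) n k))
    -- (iii)
    × (∀ n → m ≤ n → W (3 * n) ≡ neg1^ n *ℚ (ofℕ ((3 * n) !) *ℚ det n (matA m n)))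
    × (∀ n → m ≤ n → V (3 * n) ≡ neg1^ n *ℚ (ofℕ ((3 * n) !) *ℚ det n (matB m n)))
proposition3 m 1≤m W V W-inv V-inv =
    (Le.W-zero , WLe-recurrence {m} {W} W-inv)
  , (Ge.W-zero , WGe-vanishes {m} {V} V-inv , WGe-recurrence {m} {V} 1≤m V-inv)
  , Le.W-compositions
  , Ge.W-compositions
  , (λ n _ → Le.W-det n (hessenbergEntry-isToeplitzHessenberg (λ i → i ≤ᵇ m) n))
  , (λ n _ → Ge.W-det n (hessenbergEntry-isToeplitzHessenberg (λ i → m ≤ᵇ i) n))
  where
  module Le = WLe {m} {W} W-inv
  module Ge = WGe {m} {V} V-inv
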